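{- For every $k\ge1$, the graph $G_k$ of the Burling sequence is (isomorphic to) the underlying graph of the oriented graph fully derived from the Burling tree $T_k$ of the tree sequence, via an isomorphism that maps $\mathcal S_k$ onto the principal set $\mathcal P(T_k)$.
   Context: A Burling tree is a 4-tuple $(T,r,\lambda,c)$: $T$ a rooted tree with root $r$; $\lambda$ assigns to each non-leaf $v$ one of its children, its last-born; for $v\neq r$ not a last-born, $c(v)$ is the vertex set of a (possibly empty) branch (downward path $v_1\dots v_k$, each $v_i$ the parent of $v_{i+1}$) starting at the last-born of the parent of $v$, and $c(v)=\varnothing$ if $v$ is a last-born or the root. The oriented graph fully derived from it has vertex set $V(T)$ and arc $uv$ iff $v\in c(u)$. A principal branch is a branch from $r$ to a leaf; the principal set $\mathcal P(T)$ is the set of vertex sets of principal branches. Tree sequence: given a Burling tree $T$ with principal set $\mathcal S$, build $\mathrm{next}_T(T)$: take a copy of $T$; for each $P\in\mathcal S$ ending at leaf $l$, add a child $l_P$ of $l$, declare it the last-born of $l$, and attach a copy $T_P$ of $T$ by identifying its root with $l_P$ (with principal set $\mathcal S_P$); for each such $P$ and each $Q\in\mathcal S_P$ add a new leaf child $l_{P,Q}$ of $l$; extend $c$ to the copies naturally and set $c(l_{P,Q})=Q$. $T_1$ is the one-vertex Burling tree and $T_{k+1}=\mathrm{next}_T(T_k)$. Burling sequence: for a graph $G$ and set $\mathcal S$ of stable sets, $\mathrm{next}(G,\mathcal S)=(G',\mathcal S')$ where $G'$ is a copy of $G$ plus, for each $S\in\mathcal S$, a new copy $G_S$ of $G$ (with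 copy $\mathcal S_S$ of $\mathcal S$) and for each $Q\in\mathcal S_S$ a new vertex $v_{S,Q}$ adjacent exactly to $Q$; $\mathcal S'=\{S\cup Q,\ S\cup\{v_{S,Q}\}: S\in\mathcal S, Q\in\mathcal S_S\}$. $G_1=K_1$, $\mathcal S_1=\{V(G_1)\}$, $(G_{k+1},\mathcal S_{k+1})=\mathrm{next}(G_k,\mathcal S_k)$. -}

module Defs where

open import Data.Nat using (ℕ; zero; suc)
open import Data.Unit using (⊤; tt)
open import Data.Empty using (⊥)
open import Data.Bool using (Bool)
open import Data.Sum using (_⊎_; inj₁; inj₂)
open import Data.Product using (Σ; _×_; _,_)
open import Data.List using (List; []; _∷_)
open import Data.List.Membership.Propositional using (_∈_)
open import Relation.Nullary using (¬_)
open import Relation.Binary.PropositionalEquality using (_≡_)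
open import Function.Bundles using (_↔_; _⇔_; Inverse)

-- Graphs equipped with an indexed family of (stable) vertex sets.
-- V : vertices, E : (symmetric) adjacency, I : index set of the family 𝒮,
-- mem S v : v belongs to the set with index S.

record GS : Set₁ where
  field
    V   : Set
    E   : V → V → Set
    I   : Set
    mem : I → V → Set

-- next(G,𝒮): vertices are  V(G)  ⊎  Σ_{S∈𝒮} ( V(G_S) ⊎ {v_{S,Q} : Q ∈ 𝒮_S} )
nextG : GS → GS
nextG G = record { V = V' ; E = E' ; I = I' ; mem = mem' }
  where
  open GS G
  V' : Set
  V' = V ⊎ (I × (V ⊎ I))
  E' : V' → V' → Set
  E' (inj₁ u) (inj₁ v) = E u v
  E' (inj₂ (S , inj₁ u)) (inj₂ (S' , inj₁ v)) = S ≡ S' × E u v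
  E' (inj₂ (S , inj₂ Q)) (inj₂ (S' , inj₁ v)) = S ≡ S' × mem Q v
  E' (inj₂ (S , inj₁ v)) (inj₂ (S' , inj₂ Q)) = S ≡ S' × mem Q v
  E' _ _ = ⊥
  -- inj₁ (S , Q) ↦ S ∪ Q ;  inj₂ (S , Q) ↦ S ∪ {v_{S,Q}}
  I' : Set
  I' = (I × I) ⊎ (I × I)
  mem' : I' → V' → Set
  mem' (inj₁ (S , Q)) (inj₁ v) = mem S v
  mem' (inj₁ (S , Q)) (inj₂ (S' , inj₁ v)) = S ≡ S' × mem Q v
  mem' (inj₁ (S , Q)) (inj₂ (S' , inj₂ Q')) = ⊥
  mem' (inj₂ (S , Q)) (inj₁ v) = mem S v
  mem' (inj₂ (S , Q)) (inj₂ (S' , inj₁ v)) = ⊥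
  mem' (inj₂ (S , Q)) (inj₂ (S' , inj₂ Q')) = S ≡ S' × Q ≡ Q'

G₁ : GS
G₁ = record { V = ⊤ ; E = λ _ _ → ⊥ ; I = ⊤ ; mem = λ _ _ → ⊤ }

-- Burling sequence, indexed from 1 (index 0 is an unused dummy)
Gseq : ℕ → GS
Gseq zero = G₁
Gseq (suc zero) = G₁
Gseq (suc (suc n)) = nextG (Gseq (suc n))

-- Burling trees.
-- parent u v : u is the parent of v;  lastBorn u v : v = λ(u);
-- c u v : v ∈ c(u).  Lf / leaf : an enumeration of the leaves of the tree
-- (used only to iterate "for each principal branch P", principal branches
-- being in bijection with leaves).

record BT : Set₁ where
  field
    V        : Set
    root     : V
    parent   : V → V → Set
    lastBorn : V → V → Set
    c        : V → V → Set
    Lf       : Set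
    leaf     : Lf → V

data Path (T : BT) : BT.V T → BT.V T → List (BT.V T) → Set where
  single : ∀ v → Path T v v (v ∷ [])
  step   : ∀ {u w v vs} → BT.parent T u w → Path T w v vs → Path T u v (u ∷ vs)

IsLeaf : (T : BT) → BT.V T → Set
IsLeaf T l = ∀ u → ¬ BT.parent T l u

OnBranchTo : (T : BT) → BT.V T → BT.V T → Set
OnBranchTo T l x = Σ (List (BT.V T)) λ vs → Path T (BT.root T) l vs × x ∈ vs

Principal : (T : BT) → (BT.V T → Set) → Set
Principal T B = Σ (BT.V T) λ l → IsLeaf T l × Σ (List (BT.V T)) λ vs →
  Path T (BT.root T) l vs × (∀ x → (B x → x ∈ vs) × (x ∈ vs → B x))

-- next_T(T): vertices are  V(T) ⊎ Σ_{P} ( V(T_P) ⊎ {l_{P,Q} : Q ∈ 𝒮_P} ),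
-- where the root of T_P is l_P.
nextT : BT → BT
nextT T = record { V = V' ; root = inj₁ root ; parent = par ; lastBorn = lb
                 ; c = c' ; Lf = Lf × (Lf ⊎ Lf) ; leaf = leaf' }
  where
  open BT T
  V' : Set
  V' = V ⊎ (Lf × (V ⊎ Lf))
  par : V' → V' → Set
  par (inj₁ u) (inj₁ v) = parent u v
  par (inj₁ u) (inj₂ (P , inj₁ v)) = u ≡ leaf P × v ≡ root
  par (inj₁ u) (inj₂ (P , inj₂ Q)) = u ≡ leaf P
  par (inj₂ (P , inj₁ u)) (inj₂ (P' , inj₁ v)) = P ≡ P' × parent u v
  par _ _ = ⊥
  lb : V' → V' → Set
  lb (inj₁ u) (inj₁ v) = lastBorn u v
  lb (inj₁ u) (inj₂ (P , inj₁ v)) = u ≡ leaf P × v ≡ root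
  lb (inj₂ (P , inj₁ u)) (inj₂ (P' , inj₁ v)) = P ≡ P' × lastBorn u v
  lb _ _ = ⊥
  c' : V' → V' → Set
  c' (inj₁ u) (inj₁ v) = c u v
  c' (inj₂ (P , inj₁ u)) (inj₂ (P' , inj₁ v)) = P ≡ P' × c u v
  c' (inj₂ (P , inj₂ Q)) (inj₂ (P' , inj₁ v)) = P ≡ P' × OnBranchTo T (leaf Q) v
  c' _ _ = ⊥
  leaf' : Lf × (Lf ⊎ Lf) → V'
  leaf' (P , inj₁ m) = inj₂ (P , inj₁ (leaf m))
  leaf' (P , inj₂ Q) = inj₂ (P , inj₂ Q)

T₁ : BT
T₁ = record { V = ⊤ ; root = tt ; parent = λ _ _ → ⊥ ; lastBorn = λ _ _ → ⊥
            ; c = λ _ _ → ⊥ ; Lf = ⊤ ; leaf = λ _ → tt }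

-- Tree sequence, indexed from 1 (index 0 is an unused dummy)
Tseq : ℕ → BT
Tseq zero = T₁
Tseq (suc zero) = T₁
Tseq (suc (suc n)) = nextT (Tseq (suc n))

-- Underlying graph of the oriented graph fully derived from T: u ~ v iff uv or vu is an arc
UAdj : (T : BT) → BT.V T → BT.V T → Set
UAdj T u v = BT.c T u v ⊎ BT.c T v u

IsoOnto : (G : GS) (T : BT) → (GS.V G ↔ BT.V T) → Set₁
IsoOnto G T f =
  (∀ u v → GS.E G u v ⇔ UAdj T (Inverse.to f u) (Inverse.to f v)) ×
  (∀ S → Principal T (λ y → GS.mem G S (Inverse.from f y))) ×
  (∀ (B : BT.V T → Set) → Principal T B →
     Σ (GS.I G) λ S → ∀ y → B y ⇔ GS.mem G S (Inverse.from f y))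

{-# OPTIONS --safe #-}
module Submission where

-- The two sequences are built by the same recursion.  next_T(T) consists of T,
-- a copy T_P of T grafted below the leaf of each principal branch P, and a new
-- leaf l_{P,Q} for each principal branch Q of T_P, with c(l_{P,Q}) = Q; next(G,𝒮)
-- consists of G, a copy G_S for each S ∈ 𝒮, and a new vertex v_{S,Q} with
-- neighbourhood Q for each Q ∈ 𝒮_S.  So one carries, by induction, a vertex
-- bijection G_k ≅ T_k together with a bijection between 𝒮_k and the leaves of
-- T_k under which each S is the vertex set of the principal branch ending at
-- its leaf; the new sets S ∪ Q and S ∪ {v_{S,Q}} then correspond to the new
-- principal branches through T_P and through l_{P,Q}.  Principal branches are
-- the same as leaves because depth strictly increases along parent edges.

open import Defs
open import Data.Empty using (⊥; ⊥-elim)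
open import Data.List using (List; _∷_; [_]; map; _++_)
open import Data.List.Membership.Propositional using (_∈_; _∉_)
open import Data.List.Membership.Propositional.Properties
  using (∈-map⁺; ∈-map⁻; ∈-++⁺ˡ; ∈-++⁺ʳ; ∈-++⁻)
open import Data.List.Relation.Unary.Any using (here)
open import Data.List.Relation.Unary.Any.Properties using (singleton⁺; singleton⁻)
open import Data.Nat using (ℕ; zero; suc; _+_; _≤_; _<_)
open import Data.Nat.Properties using (≤-refl; <⇒≤; <-irrefl; 0≢1+n)
open import Data.Product using (Σ; _×_; _,_; proj₁; proj₂)
open import Data.Product.Algebra using (×-distribˡ-⊎)
open import Data.Product.Function.NonDependent.Propositional using (_×-↔_; _×-⇔_)
open import Data.Sum using (_⊎_; inj₁; inj₂; [_,_]′)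
import Data.Sum as Sum
open import Data.Sum.Function.Propositional using (_⊎-↔_)
open import Data.Sum.Properties using (inj₁-injective)
open import Data.Unit using (tt)
open import Function using (_∘_; id)
open import Function.Bundles using (_↔_; _⇔_; Inverse; Equivalence; mk⇔)
open import Function.Construct.Composition using (_⇔-∘_)
open import Function.Construct.Symmetry using (⇔-sym)
open import Function.Definitions using (Injective)
open import Function.Properties.Equivalence using (⇔-setoid)
open import Function.Properties.Inverse using (↔-refl; ↔-trans; ↔-sym)
open import Level using (0ℓ)
open import Relation.Nullary using (¬_)
import Relation.Binary.Reasoning.Setoid as SetoidReasoning
open import Relation.Binary.PropositionalEquality
  using (_≡_; _≢_; refl; sym; trans; cong; subst)

open Equivalence using () renaming (to to ⇔-to; from to ⇔-from)

private
  variable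
    A B C : Set
    a a′ : A
    x : A
    xs ys : List A

-- Both nextG and nextT have vertex type  X ⊎ (I × (X ⊎ I)):  the old vertices,
-- the copy indexed by S (resp. P), and the new vertex v_{S,Q} (resp. l_{P,Q}).
pattern base v  = inj₁ v
pattern copy S v = inj₂ (S , inj₁ v)
pattern new S Q  = inj₂ (S , inj₂ Q)

∉-map : (f : A → B) {y : B} → (∀ x → y ≢ f x) → y ∉ map f xs
∉-map f y∉img y∈ = let x , _ , y≡fx = ∈-map⁻ f y∈ in y∉img x y≡fx

∈-map⇔∈ : {f : A → B} → Injective _≡_ _≡_ f → (f x ∈ map f xs) ⇔ (x ∈ xs)
∈-map⇔∈ {xs = xs} f-inj = mk⇔
  (λ fx∈ → let _ , x′∈ , fx≡fx′ = ∈-map⁻ _ fx∈ in subst (_∈ xs) (sym (f-inj fx≡fx′)) x′∈)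
  (∈-map⁺ _)

∈-map₂⇔ : {h : A → B → C} → (∀ {a₁ a₂ x₁ x₂} → h a₁ x₁ ≡ h a₂ x₂ → a₁ ≡ a₂ × x₁ ≡ x₂) →
          (h a x ∈ map (h a′) xs) ⇔ (a′ ≡ a × x ∈ xs)
∈-map₂⇔ {a = a} {x = x} {xs = xs} h-inj = mk⇔
  (λ hax∈ → let _ , x′∈ , hax≡ = ∈-map⁻ _ hax∈
                a≡a′ , x≡x′ = h-inj hax≡
            in sym a≡a′ , subst (_∈ xs) (sym x≡x′) x′∈)
  (λ { (refl , x∈) → ∈-map⁺ _ x∈ })

∈-++⇔∈ˡ : x ∉ ys → (x ∈ xs ++ ys) ⇔ (x ∈ xs)
∈-++⇔∈ˡ {xs = xs} x∉ys = mk⇔ ([ id , ⊥-elim ∘ x∉ys ]′ ∘ ∈-++⁻ xs) ∈-++⁺ˡ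

∈-++⇔∈ʳ : x ∉ xs → (x ∈ xs ++ ys) ⇔ (x ∈ ys)
∈-++⇔∈ʳ {xs = xs} x∉xs = mk⇔ ([ ⊥-elim ∘ x∉xs , id ]′ ∘ ∈-++⁻ xs) (∈-++⁺ʳ xs)

∉-++ : ∀ xs → x ∉ xs → x ∉ ys → x ∉ xs ++ ys
∉-++ xs x∉xs x∉ys = [ x∉xs , x∉ys ]′ ∘ ∈-++⁻ xs

path-++ : ∀ {T a b c d vs ws} → Path T a b vs → BT.parent T b c → Path T c d ws →
          Path T a d (vs ++ ws)
path-++ (single _) b→c q = step b→c q
path-++ (step p r) b→c q = step p (path-++ r b→c q)

path-map : ∀ {T T′ a b vs} (e : BT.V T → BT.V T′) →
           (∀ {u v} → BT.parent T u v → BT.parent T′ (e u) (e v)) →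
           Path T a b vs → Path T′ (e a) (e b) (map e vs)
path-map e e-parent (single _) = single _
path-map e e-parent (step p q) = step (e-parent p) (path-map e e-parent q)

principal-resp-⇔ : ∀ {T B C} → (∀ x → B x ⇔ C x) → Principal T B → Principal T C
principal-resp-⇔ B⇔C (l , l-leaf , vs , path , B≈vs) =
  l , l-leaf , vs , path ,
  λ x → proj₁ (B≈vs x) ∘ ⇔-from (B⇔C x) , ⇔-to (B⇔C x) ∘ proj₂ (B≈vs x)

record Graded (T : BT) : Set where
  field
    depth         : BT.V T → ℕ
    depth-root    : depth (BT.root T) ≡ 0
    depth-parent  : ∀ u v → BT.parent T u v → depth v ≡ suc (depth u)
    parent-unique : ∀ u u′ v → BT.parent T u v → BT.parent T u′ v → u ≡ u′

module _ {T : BT} (graded : Graded T) where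
  open BT T
  open Graded graded

  root-parentless : ∀ u → ¬ parent u root
  root-parentless u p = 0≢1+n (trans (sym depth-root) (depth-parent u root p))

  path-depth-≤ : ∀ {a b vs} → Path T a b vs → depth a ≤ depth b
  parent-path-depth-< : ∀ {u w b vs} → parent u w → Path T w b vs → depth u < depth b

  path-depth-≤ (single _) = ≤-refl
  path-depth-≤ (step p q) = <⇒≤ (parent-path-depth-< p q)

  parent-path-depth-< {u} {w} {b} p q = subst (_≤ depth b) (depth-parent u w p) (path-depth-≤ q)

  path-unique : ∀ {a a′ b vs vs′} → Path T a b vs → Path T a′ b vs′ →
                depth a ≡ depth a′ → a ≡ a′ × vs ≡ vs′
  path-unique (single _) (single _) _ = refl , refl
  path-unique (single _) (step p q) d = ⊥-elim (<-irrefl (sym d) (parent-path-depth-< p q))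
  path-unique (step p q) (single _) d = ⊥-elim (<-irrefl d (parent-path-depth-< p q))
  path-unique (step {a} {w} p q) (step {a′} {w′} p′ q′) d
    with path-unique q q′ (trans (depth-parent a w p)
                                 (trans (cong suc d) (sym (depth-parent a′ w′ p′))))
  ... | refl , refl = let a≡a′ = parent-unique a a′ w p p′ in a≡a′ , cong (_∷ _) a≡a′

  root-path-unique : ∀ {l vs vs′} → Path T root l vs → Path T root l vs′ → vs ≡ vs′
  root-path-unique p q = proj₂ (path-unique p q refl)

record WellFormed (T : BT) : Set where
  field
    graded        : Graded T
    branch        : BT.Lf T → List (BT.V T)
    branch-path   : ∀ P → Path T (BT.root T) (BT.leaf T P) (branch P)
    leaf-isLeaf   : ∀ P → IsLeaf T (BT.leaf T P)
    leaf-complete : ∀ l → IsLeaf T l → Σ (BT.Lf T) λ P → l ≡ BT.leaf T P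

module _ {T : BT} (wf : WellFormed T) where
  open BT T
  open WellFormed wf

  ∈branch⇔onBranchTo : ∀ P v → (v ∈ branch P) ⇔ OnBranchTo T (leaf P) v
  ∈branch⇔onBranchTo P v = mk⇔
    (λ v∈ → branch P , branch-path P , v∈)
    (λ { (vs , path , v∈) → subst (v ∈_) (root-path-unique graded path (branch-path P)) v∈ })

  branch-principal : ∀ P → Principal T (_∈ branch P)
  branch-principal P = leaf P , leaf-isLeaf P , branch P , branch-path P , λ _ → id , id

  principal-branch : ∀ {B} → Principal T B → Σ Lf λ P → ∀ v → B v ⇔ (v ∈ branch P)
  principal-branch (l , l-leaf , vs , path , B≈vs) with leaf-complete l l-leaf
  ... | P , refl = P , λ v → mk⇔ (subst (v ∈_) vs≡ ∘ proj₁ (B≈vs v))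
                                 (proj₂ (B≈vs v) ∘ subst (v ∈_) (sym vs≡))
    where vs≡ = root-path-unique graded path (branch-path P)

wellFormed-T₁ : WellFormed T₁
wellFormed-T₁ = record
  { graded        = record { depth = λ _ → 0 ; depth-root = refl
                           ; depth-parent = λ _ _ () ; parent-unique = λ _ _ _ () }
  ; branch        = λ _ → [ tt ]
  ; branch-path   = λ _ → single tt
  ; leaf-isLeaf   = λ _ _ ()
  ; leaf-complete = λ _ _ → tt , refl
  }

module NextTree {T : BT} (wf : WellFormed T) where
  open BT T
  open WellFormed wf
  open Graded graded

  T⁺ : BT
  T⁺ = nextT T

  data Parent⁺ : BT.V T⁺ → BT.V T⁺ → Set where
    base-edge  : ∀ {u v} → parent u v → Parent⁺ (base u) (base v)
    graft-edge : ∀ {P} → Parent⁺ (base (leaf P)) (copy P root)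
    new-edge   : ∀ {P Q} → Parent⁺ (base (leaf P)) (new P Q)
    copy-edge  : ∀ {P u v} → parent u v → Parent⁺ (copy P u) (copy P v)

  parent-view : ∀ u v → BT.parent T⁺ u v → Parent⁺ u v
  parent-view (base u)   (base v)   p             = base-edge p
  parent-view (base u)   (copy P v) (refl , refl) = graft-edge
  parent-view (base u)   (new P Q)  refl          = new-edge
  parent-view (copy P u) (copy _ v) (refl , p)    = copy-edge p
  parent-view (copy P u) (base v)   ()
  parent-view (copy P u) (new _ Q)  ()
  parent-view (new P Q)  (base v)   ()
  parent-view (new P Q)  (copy _ v) ()
  parent-view (new P Q)  (new _ _)  ()

  depth⁺ : BT.V T⁺ → ℕ
  depth⁺ (base u)   = depth u
  depth⁺ (copy P u) = depth u + suc (depth (leaf P))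
  depth⁺ (new P Q)  = suc (depth (leaf P))

  depth⁺-parent : ∀ u v → BT.parent T⁺ u v → depth⁺ v ≡ suc (depth⁺ u)
  depth⁺-parent u v p with parent-view u v p
  ... | base-edge q        = depth-parent _ _ q
  ... | graft-edge {P}     = cong (_+ suc (depth (leaf P))) depth-root
  ... | new-edge           = refl
  ... | copy-edge {P} q    = cong (_+ suc (depth (leaf P))) (depth-parent _ _ q)

  parent⁺-unique : ∀ u u′ v → BT.parent T⁺ u v → BT.parent T⁺ u′ v → u ≡ u′
  parent⁺-unique u u′ v p p′ with parent-view u v p | parent-view u′ v p′
  ... | base-edge q  | base-edge q′ = cong base (parent-unique _ _ _ q q′)
  ... | graft-edge   | graft-edge   = refl
  ... | new-edge     | new-edge     = refl
  ... | copy-edge q  | copy-edge q′ = cong (copy _) (parent-unique _ _ _ q q′)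
  ... | graft-edge   | copy-edge q′ = ⊥-elim (root-parentless graded _ q′)
  ... | copy-edge q  | graft-edge   = ⊥-elim (root-parentless graded _ q)

  graded⁺ : Graded T⁺
  graded⁺ = record
    { depth = depth⁺ ; depth-root = depth-root
    ; depth-parent = depth⁺-parent ; parent-unique = parent⁺-unique }

  branch⁺ : BT.Lf T⁺ → List (BT.V T⁺)
  branch⁺ (P , inj₁ m) = map base (branch P) ++ map (copy P) (branch m)
  branch⁺ (P , inj₂ Q) = map base (branch P) ++ [ new P Q ]

  branch⁺-path : ∀ P → Path T⁺ (BT.root T⁺) (BT.leaf T⁺ P) (branch⁺ P)
  branch⁺-path (P , inj₁ m) =
    path-++ (path-map base id (branch-path P)) (refl , refl)
            (path-map (copy P) (refl ,_) (branch-path m))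
  branch⁺-path (P , inj₂ Q) = path-++ (path-map base id (branch-path P)) refl (single _)

  leaf⁺-isLeaf : ∀ P → IsLeaf T⁺ (BT.leaf T⁺ P)
  leaf⁺-isLeaf (P , inj₁ m) v p with parent-view (copy P (leaf m)) v p
  ... | copy-edge q = leaf-isLeaf m _ q
  leaf⁺-isLeaf (P , inj₂ Q) v p with parent-view (new P Q) v p
  ... | ()

  leaf⁺-complete : ∀ l → IsLeaf T⁺ l → Σ (BT.Lf T⁺) λ P → l ≡ BT.leaf T⁺ P
  leaf⁺-complete (base u) u-leaf =
    let P , u≡leaf = leaf-complete u (λ v → u-leaf (base v))
    in ⊥-elim (u-leaf (copy P root) (u≡leaf , refl))
  leaf⁺-complete (copy P u) u-leaf =
    let m , u≡leaf = leaf-complete u (λ v → u-leaf (copy P v) ∘ (refl ,_))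
    in (P , inj₁ m) , cong (copy P) u≡leaf
  leaf⁺-complete (new P Q) _ = (P , inj₂ Q) , refl

  wellFormed⁺ : WellFormed T⁺
  wellFormed⁺ = record
    { graded = graded⁺ ; branch = branch⁺ ; branch-path = branch⁺-path
    ; leaf-isLeaf = leaf⁺-isLeaf ; leaf-complete = leaf⁺-complete }

record Correspondence (G : GS) (T : BT) : Set where
  field
    vertex     : GS.V G ↔ BT.V T
    index      : GS.I G ↔ BT.Lf T
    wellFormed : WellFormed T
  open Inverse vertex using (to; from)
  open WellFormed wellFormed using (branch)
  field
    adjacency  : ∀ u v → GS.E G u v ⇔ UAdj T (to u) (to v)
    mem-branch : ∀ S y → GS.mem G S (from y) ⇔ (y ∈ branch (Inverse.to index S))

correspondence⇒isoOnto : ∀ {G T} → Correspondence G T → Σ (GS.V G ↔ BT.V T) (IsoOnto G T)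
correspondence⇒isoOnto {G} {T} C = vertex , adjacency , set⇒principal , principal⇒set
  where
  open Correspondence C
  open Inverse index using (to; from; strictlyInverseˡ)
  open WellFormed wellFormed using (branch)

  set⇒principal : ∀ S → Principal T (λ y → GS.mem G S (Inverse.from vertex y))
  set⇒principal S = principal-resp-⇔ (⇔-sym ∘ mem-branch S) (branch-principal wellFormed (to S))

  principal⇒set : ∀ B → Principal T B →
                  Σ (GS.I G) λ S → ∀ y → B y ⇔ GS.mem G S (Inverse.from vertex y)
  principal⇒set B B-principal =
    let P , B≈branch = principal-branch wellFormed B-principal
        B≈branch′ = subst (λ Q → ∀ y → B y ⇔ (y ∈ branch Q)) (sym (strictlyInverseˡ P)) B≈branch
    in from P , λ y → ⇔-sym (mem-branch (from P) y) ⇔-∘ B≈branch′ y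

correspondence₁ : Correspondence G₁ T₁
correspondence₁ = record
  { vertex     = ↔-refl
  ; index      = ↔-refl
  ; wellFormed = wellFormed-T₁
  ; adjacency  = λ _ _ → mk⇔ (λ ()) [ (λ ()) , (λ ()) ]′
  ; mem-branch = λ _ _ → mk⇔ (λ _ → here refl) _
  }

module NextCorrespondence {G : GS} {T : BT} (C : Correspondence G T) where
  open Correspondence C
  open BT T using (leaf)
  open WellFormed wellFormed using (branch)
  open NextTree wellFormed using (T⁺; branch⁺; wellFormed⁺)
  open Inverse vertex using (strictlyInverseʳ) renaming (to to ⟦_⟧; from to ⟦_⟧⁻¹)
  open Inverse index using (inverseˡ; inverseʳ) renaming (to to ⟪_⟫; from to ⟪_⟫⁻¹)
  open SetoidReasoning (⇔-setoid 0ℓ)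

  G⁺ : GS
  G⁺ = nextG G

  vertex⁺ : GS.V G⁺ ↔ BT.V T⁺
  vertex⁺ = vertex ⊎-↔ (index ×-↔ (vertex ⊎-↔ index))

  index⁺ : GS.I G⁺ ↔ BT.Lf T⁺
  index⁺ = ↔-trans (↔-sym (×-distribˡ-⊎ _ _ _ _)) (index ×-↔ (index ⊎-↔ index))

  no-edge : ⊥ ⇔ (⊥ ⊎ ⊥)
  no-edge = mk⇔ (λ ()) [ (λ ()) , (λ ()) ]′

  ⟪⟫-injective : ∀ {S S′} → ⟪ S ⟫ ≡ ⟪ S′ ⟫ → S ≡ S′
  ⟪⟫-injective e = trans (sym (inverseʳ refl)) (inverseʳ e)

  ≡⟪⟫⁻¹⇔⟪⟫≡ : ∀ {S P} → (S ≡ ⟪ P ⟫⁻¹) ⇔ (⟪ S ⟫ ≡ P)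
  ≡⟪⟫⁻¹⇔⟪⟫≡ = mk⇔ inverseˡ (λ e → sym (inverseʳ (sym e)))

  -- N(v_{S,Q}) = Q on the graph side matches c(l_{P,Q}) = Q on the tree side.
  mem⇔onBranchTo : ∀ Q v → GS.mem G Q v ⇔ OnBranchTo T (leaf ⟪ Q ⟫) ⟦ v ⟧
  mem⇔onBranchTo Q v =
    ∈branch⇔onBranchTo wellFormed ⟪ Q ⟫ ⟦ v ⟧
    ⇔-∘ subst (λ w → GS.mem G Q w ⇔ (⟦ v ⟧ ∈ branch ⟪ Q ⟫)) (strictlyInverseʳ v)
              (mem-branch Q ⟦ v ⟧)

  adjacency⁺ : ∀ u v → GS.E G⁺ u v ⇔ UAdj T⁺ (Inverse.to vertex⁺ u) (Inverse.to vertex⁺ v)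
  adjacency⁺ (base u)   (base v)    = adjacency u v
  adjacency⁺ (copy S u) (copy S′ v) = mk⇔
    (λ { (refl , uv) → Sum.map (refl ,_) (refl ,_) (⇔-to (adjacency u v) uv) })
    (λ { (inj₁ (e , uv)) → ⟪⟫-injective e , ⇔-from (adjacency u v) (inj₁ uv)
       ; (inj₂ (e , vu)) → sym (⟪⟫-injective e) , ⇔-from (adjacency u v) (inj₂ vu) })
  adjacency⁺ (new S Q)  (copy S′ v) = mk⇔
    (λ { (refl , v∈Q) → inj₁ (refl , ⇔-to (mem⇔onBranchTo Q v) v∈Q) })
    (λ { (inj₁ (e , v∈Q)) → ⟪⟫-injective e , ⇔-from (mem⇔onBranchTo Q v) v∈Q })
  adjacency⁺ (copy S v) (new S′ Q)  = mk⇔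
    (λ { (refl , v∈Q) → inj₂ (refl , ⇔-to (mem⇔onBranchTo Q v) v∈Q) })
    (λ { (inj₂ (e , v∈Q)) → sym (⟪⟫-injective e) , ⇔-from (mem⇔onBranchTo Q v) v∈Q })
  adjacency⁺ (base u)   (copy S v)  = no-edge
  adjacency⁺ (base u)   (new S Q)   = no-edge
  adjacency⁺ (copy S u) (base v)    = no-edge
  adjacency⁺ (new S Q)  (base v)    = no-edge
  adjacency⁺ (new S Q)  (new S′ Q′) = no-edge

  mem-branch⁺ : ∀ S y →
                GS.mem G⁺ S (Inverse.from vertex⁺ y) ⇔ (y ∈ branch⁺ (Inverse.to index⁺ S))
  mem-branch⁺ (inj₁ (S , Q)) (base x) = begin
    GS.mem G S ⟦ x ⟧⁻¹               ≈⟨ mem-branch S x ⟩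
    x ∈ branch ⟪ S ⟫                 ≈⟨ ∈-map⇔∈ inj₁-injective ⟨
    base x ∈ map base (branch ⟪ S ⟫) ≈⟨ ∈-++⇔∈ˡ (∉-map (copy _) λ _ ()) ⟨
    base x ∈ branch⁺ (⟪ S ⟫ , inj₁ ⟪ Q ⟫) ∎
  mem-branch⁺ (inj₁ (S , Q)) (copy P x) = begin
    (S ≡ ⟪ P ⟫⁻¹ × GS.mem G Q ⟦ x ⟧⁻¹)         ≈⟨ ≡⟪⟫⁻¹⇔⟪⟫≡ ×-⇔ mem-branch Q x ⟩
    (⟪ S ⟫ ≡ P × x ∈ branch ⟪ Q ⟫)             ≈⟨ ∈-map₂⇔ (λ { refl → refl , refl }) ⟨
    copy P x ∈ map (copy ⟪ S ⟫) (branch ⟪ Q ⟫) ≈⟨ ∈-++⇔∈ʳ (∉-map base λ _ ()) ⟨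
    copy P x ∈ branch⁺ (⟪ S ⟫ , inj₁ ⟪ Q ⟫) ∎
  mem-branch⁺ (inj₁ (S , Q)) (new P Q′) =
    mk⇔ (λ ()) (∉-++ (map base (branch ⟪ S ⟫)) (∉-map base λ _ ()) (∉-map (copy ⟪ S ⟫) λ _ ()))
  mem-branch⁺ (inj₂ (S , Q)) (base x) = begin
    GS.mem G S ⟦ x ⟧⁻¹               ≈⟨ mem-branch S x ⟩
    x ∈ branch ⟪ S ⟫                 ≈⟨ ∈-map⇔∈ inj₁-injective ⟨
    base x ∈ map base (branch ⟪ S ⟫) ≈⟨ ∈-++⇔∈ˡ ((λ ()) ∘ singleton⁻) ⟨
    base x ∈ branch⁺ (⟪ S ⟫ , inj₂ ⟪ Q ⟫) ∎
  mem-branch⁺ (inj₂ (S , Q)) (copy P x) =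
    mk⇔ (λ ()) (∉-++ (map base (branch ⟪ S ⟫)) (∉-map base λ _ ()) ((λ ()) ∘ singleton⁻))
  mem-branch⁺ (inj₂ (S , Q)) (new P Q′) = begin
    (S ≡ ⟪ P ⟫⁻¹ × Q ≡ ⟪ Q′ ⟫⁻¹)   ≈⟨ ≡⟪⟫⁻¹⇔⟪⟫≡ ×-⇔ ≡⟪⟫⁻¹⇔⟪⟫≡ ⟩
    (⟪ S ⟫ ≡ P × ⟪ Q ⟫ ≡ Q′)       ≈⟨ mk⇔ (λ { (refl , refl) → refl }) (λ { refl → refl , refl }) ⟩
    new P Q′ ≡ new ⟪ S ⟫ ⟪ Q ⟫     ≈⟨ mk⇔ singleton⁺ singleton⁻ ⟩
    new P Q′ ∈ [ new ⟪ S ⟫ ⟪ Q ⟫ ] ≈⟨ ∈-++⇔∈ʳ (∉-map base λ _ ()) ⟨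
    new P Q′ ∈ branch⁺ (⟪ S ⟫ , inj₂ ⟪ Q ⟫) ∎

  correspondence⁺ : Correspondence G⁺ T⁺
  correspondence⁺ = record
    { vertex = vertex⁺ ; index = index⁺ ; wellFormed = wellFormed⁺
    ; adjacency = adjacency⁺ ; mem-branch = mem-branch⁺ }

correspondence : ∀ n → Correspondence (Gseq (suc n)) (Tseq (suc n))
correspondence zero    = correspondence₁
correspondence (suc n) = NextCorrespondence.correspondence⁺ (correspondence n)

lemma4p5 : ∀ (k : ℕ) → 1 ≤ k →
    Σ (GS.V (Gseq k) ↔ BT.V (Tseq k)) λ f → IsoOnto (Gseq k) (Tseq k) f
lemma4p5 zero    ()
lemma4p5 (suc n) _ = correspondence⇒isoOnto (correspondence n)
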